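{- Let $\xi>0$, $d>0$, $\delta>0$ and $n\in\mathbb{N}$ satisfy $\frac{d\xi^3-\delta}{2}n\geq 1$. Let $H=(U\,\dot\cup\, V\,\dot\cup\, W,E)$ be a $3$-graph with $|U|=|V|=|W|=n$ such that $U,V,W$ are weakly $(\delta,d)$-quasirandom in $H$. Then at least $(1-\xi)3n$ vertices of $H$ can be covered by vertex-disjoint tight paths of length at least $\frac{d\xi^3-\delta}{2}n-2$.
   Context: A 3-graph $H=(X,E)$ has $E\subseteq X^{(3)}$. For $V_1,V_2,V_3\subseteq X$ let $e(V_1,V_2,V_3)=|\{(v_1,v_2,v_3)\in V_1\times V_2\times V_3:\{v_1,v_2,v_3\}\in E\}|$. The sets $V_1,V_2,V_3$ are weakly $(\delta,d)$-quasirandom in $H$ if for all $U_1\subseteq V_1$, $U_2\subseteq V_2$, $U_3\subseteq V_3$ we have $|e(U_1,U_2,U_3)-d|U_1||U_2||U_3||\leq\delta|V_1||V_2||V_3|$. A tight path of length $\ell$ is a 3-graph on $\ell+2$ distinct vertices ordered $x_1,\dots,x_{\ell+2}$ whose edges are exactly $\{x_i,x_{i+1},x_{i+2}\}$, $i\in[\ell]$ (length = number of edges); paths here are subhypergraphs of $H$. Rounding to integers is ignored.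
   Formalization: The parameters ξ, d and δ are positive rationals. -}

module Defs where

open import Data.Bool using (Bool; true; false; _∧_; if_then_else_)
open import Data.Nat as ℕ using (ℕ; zero; suc)
open import Data.Fin using (Fin; zero; suc)
open import Data.Fin.Subset using (Subset) renaming (∣_∣ to #_)
open import Data.Vec using (lookup)
open import Data.List using (List; []; _∷_; map; allFin; length; concat)
open import Data.Nat.ListAction using (sum)
open import Data.List.Relation.Unary.All using (All)
open import Data.List.Relation.Unary.Unique.Propositional using (Unique)
open import Data.Product using (_×_; _,_; Σ)
open import Data.Unit using (⊤)
open import Relation.Binary.PropositionalEquality using (_≡_)
open import Data.Integer using (+_)
open import Data.Rational using (ℚ; _/_; _-_; _*_; _≤_; ∣_∣; 1ℚ)

-- Vertex set X = U ∪̇ V ∪̇ W with |U| = |V| = |W| = n: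
-- vertex (0 , a) ∈ U, (1 , b) ∈ V, (2 , c) ∈ W.
Vertex : ℕ → Set
Vertex n = Fin 3 × Fin n

-- A 3-graph on X: edge x y z = true iff {x,y,z} ∈ E.  The indicator is
-- symmetric and vanishes on non-distinct triples, so it encodes E ⊆ X^(3).
record ThreeGraph (n : ℕ) : Set where
  field
    edge     : Vertex n → Vertex n → Vertex n → Bool
    sym₁₂    : ∀ x y z → edge x y z ≡ edge y x z
    sym₂₃    : ∀ x y z → edge x y z ≡ edge x z y
    loopless : ∀ x z → edge x x z ≡ false
open ThreeGraph public

⟦_⟧ : ℕ → ℚ
⟦ k ⟧ = + k / 1

∑ : (n : ℕ) → (Fin n → ℕ) → ℕ
∑ n f = sum (map f (allFin n))

indicator : Bool → ℕ
indicator b = if b then 1 else 0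

-- e(U₁,U₂,U₃) for U₁ ⊆ U, U₂ ⊆ V, U₃ ⊆ W (ordered triples in U₁×U₂×U₃ forming an edge)
e : {n : ℕ} → ThreeGraph n → Subset n → Subset n → Subset n → ℕ
e {n} H U₁ U₂ U₃ =
  ∑ n λ a → ∑ n λ b → ∑ n λ c →
    indicator (lookup U₁ a ∧ lookup U₂ b ∧ lookup U₃ c
               ∧ edge H (zero , a) (suc zero , b) (suc (suc zero) , c))

WeaklyQuasirandom : {n : ℕ} → ℚ → ℚ → ThreeGraph n → Set
WeaklyQuasirandom {n} δ d H =
  (U₁ U₂ U₃ : Subset n) →
    ∣ ⟦ e H U₁ U₂ U₃ ⟧ - d * ⟦ # U₁ ⟧ * ⟦ # U₂ ⟧ * ⟦ # U₃ ⟧ ∣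
      ≤ δ * ⟦ n ⟧ * ⟦ n ⟧ * ⟦ n ⟧

ConsecutiveEdges : {n : ℕ} → ThreeGraph n → List (Vertex n) → Set
ConsecutiveEdges H (x ∷ y ∷ z ∷ rest) =
  (edge H x y z ≡ true) × ConsecutiveEdges H (y ∷ z ∷ rest)
ConsecutiveEdges H _ = ⊤

record TightPath {n : ℕ} (H : ThreeGraph n) : Set where
  field
    ℓ        : ℕ
    vertices : List (Vertex n)
    size     : length vertices ≡ ℓ ℕ.+ 2
    distinct : Unique vertices
    edges    : ConsecutiveEdges H vertices
open TightPath public

CoverByTightPaths : {n : ℕ} → ThreeGraph n → (L C : ℚ) → Set
CoverByTightPaths H L C =
  Σ (List (TightPath H)) λ Ps →
    All (λ P → L ≤ ⟦ ℓ P ⟧) Ps ×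
    Unique (concat (map vertices Ps)) ×
    C ≤ ⟦ length (concat (map vertices Ps)) ⟧

module Submission where

-- Put Q = (dξ³ - δ)n/2 and choose t with 3t < 2Q ≤ 3(t + 1).  Tight paths of
-- length 3t + 1 ≥ Q - 2 are extracted one after another from the uncovered
-- parts A ⊆ U, B ⊆ V, C ⊆ W, which always have a common size m.  While m ≥ ξn,
-- quasirandomness gives e(A,B,C) ≥ (dξ³ - δ)n³ = 2Qn² > 3tn², and then
--  * pruning: repeatedly deleting the triples through a pair of codegree ≤ t
--    removes at most t · 3n² triples, so a nonempty subsystem survives in which
--    every pair inside a triple has codegree > t;
--  * greedy chains: in it, any triple starts a chain of t + 1 triples with
--    distinct coordinates, found one new vertex at a time by pigeonhole; the
--    chain spells out a tight path c b a c₀ b₀ a₀ … on 3(t + 1) vertices.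
-- Removing that path lowers m by t + 1.  When m < ξn the procedure stops, and
-- fewer than 3ξn vertices are left uncovered.

open import Defs
open import Data.Nat using (ℕ)
open import Relation.Nullary using (Dec; yes; no)

module Sums where
  open import Data.Bool using (true; false)
  open import Data.Nat using (ℕ; zero; suc; _+_; _*_; _≤_; _<_; z≤n; s≤s)
  open import Data.Nat.Properties
    using (+-0-commutativeMonoid; +-mono-≤; +-mono-<-≤; +-mono-≤-<; +-assoc; +-comm; ≤-refl)
  open import Data.Fin using (Fin; zero; suc)
  open import Data.Fin.Properties using (suc-injective)
  open import Data.List.Properties using (map-tabulate)
  open import Data.Nat.ListAction using () renaming (sum to sumList)
  open import Data.Product using (∃; _,_)
  open import Function using (_∘_; id)
  open import Relation.Binary.PropositionalEquality
  open import Relation.Nullary using (¬_)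

  open import Algebra.Properties.CommutativeMonoid.Sum +-0-commutativeMonoid public
    using (sum; sum-syntax; ∑-distrib-+; ∑-comm; sum-cong-≗)

  ∑≡sum : ∀ n (f : Fin n → ℕ) → ∑ n f ≡ sum f
  ∑≡sum zero    f = refl
  ∑≡sum (suc n) f =
    cong (f zero +_) (trans (cong sumList (trans (map-tabulate suc f) (sym (map-tabulate id (f ∘ suc)))))
                            (∑≡sum n (f ∘ suc)))

  ∑-mono : ∀ {n} {f g : Fin n → ℕ} → (∀ i → f i ≤ g i) → sum f ≤ sum g
  ∑-mono {zero}  f≤g = z≤n
  ∑-mono {suc n} f≤g = +-mono-≤ (f≤g zero) (∑-mono (f≤g ∘ suc))

  ∑-mono-< : ∀ {n} {f g : Fin n → ℕ} → (∀ i → f i ≤ g i) → ∀ i → f i < g i → sum f < sum g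
  ∑-mono-< f≤g zero    f<g = +-mono-<-≤ f<g (∑-mono (f≤g ∘ suc))
  ∑-mono-< f≤g (suc i) f<g = +-mono-≤-< (f≤g zero) (∑-mono-< (f≤g ∘ suc) i f<g)

  ∑-≤-const : ∀ {n} (f : Fin n → ℕ) k → (∀ i → f i ≤ k) → sum f ≤ n * k
  ∑-≤-const {zero}  f k f≤k = z≤n
  ∑-≤-const {suc n} f k f≤k = +-mono-≤ (f≤k zero) (∑-≤-const (f ∘ suc) k (f≤k ∘ suc))

  ∑-zero : ∀ {n} (f : Fin n → ℕ) → (∀ i → f i ≡ 0) → sum f ≡ 0
  ∑-zero {zero}  f f≡0 = refl
  ∑-zero {suc n} f f≡0 = cong₂ _+_ (f≡0 zero) (∑-zero (f ∘ suc) (f≡0 ∘ suc))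

  ∑-positive⇒ : ∀ {n} (f : Fin n → ℕ) → 0 < sum f → ∃ λ i → 0 < f i
  ∑-positive⇒ {suc n} f pos with f zero in eq
  ... | suc k = zero , subst (0 <_) (sym eq) (s≤s z≤n)
  ... | zero with ∑-positive⇒ (f ∘ suc) pos
  ...   | i , fi>0 = suc i , fi>0

  term-positive⇒ : ∀ {n} (f : Fin n → ℕ) i → 0 < f i → 0 < sum f
  term-positive⇒ {n} f i fi>0 =
    subst (_< sum f) (∑-zero {n} (λ _ → 0) (λ _ → refl)) (∑-mono-< (λ _ → z≤n) i fi>0)

  ∑-bump : ∀ {n} (f g : Fin n → ℕ) i₀ k → (∀ i → ¬ i ≡ i₀ → g i ≡ f i) → g i₀ ≡ f i₀ + k →
           sum g ≡ sum f + k
  ∑-bump f g zero k same bumped = begin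
    g zero + sum (g ∘ suc)       ≡⟨ cong₂ _+_ bumped (sum-cong-≗ (λ i → same (suc i) (λ ()))) ⟩
    f zero + k + sum (f ∘ suc)   ≡⟨ +-assoc (f zero) k _ ⟩
    f zero + (k + sum (f ∘ suc)) ≡⟨ cong (f zero +_) (+-comm k _) ⟩
    f zero + (sum (f ∘ suc) + k) ≡⟨ +-assoc (f zero) _ k ⟨
    f zero + sum (f ∘ suc) + k   ∎
    where open ≡-Reasoning
  ∑-bump f g (suc i₀) k same bumped = begin
    g zero + sum (g ∘ suc)       ≡⟨ cong₂ _+_ (same zero (λ ())) (∑-bump (f ∘ suc) (g ∘ suc) i₀ k
                                      (λ i i≢i₀ → same (suc i) (i≢i₀ ∘ suc-injective)) bumped) ⟩
    f zero + (sum (f ∘ suc) + k) ≡⟨ +-assoc (f zero) _ k ⟨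
    f zero + sum (f ∘ suc) + k   ∎
    where open ≡-Reasoning

  ∑-single : ∀ {n} (f : Fin n → ℕ) i₀ → (∀ i → ¬ i ≡ i₀ → f i ≡ 0) → sum f ≡ f i₀
  ∑-single {n} f i₀ vanish = trans (∑-bump (λ _ → 0) f i₀ (f i₀) vanish refl)
                                   (cong (_+ f i₀) (∑-zero {n} (λ _ → 0) (λ _ → refl)))

  indicator-mono : ∀ {x y} → (x ≡ true → y ≡ true) → indicator x ≤ indicator y
  indicator-mono {false} x⇒y = z≤n
  indicator-mono {true}  x⇒y rewrite x⇒y refl = ≤-refl

  indicator≤1 : ∀ x → indicator x ≤ 1
  indicator≤1 true  = ≤-refl
  indicator≤1 false = z≤n

  indicator-positive : ∀ {x} → 0 < indicator x → x ≡ true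
  indicator-positive {true} _ = refl

  indicator-true : ∀ {x} → x ≡ true → 0 < indicator x
  indicator-true refl = s≤s z≤n

module Membership (n : ℕ) where
  open Sums
  open import Data.Bool using (Bool; true; false; _∨_)
  open import Data.Nat using (ℕ; suc; _+_; _≤_; _<_; z≤n; s≤s)
  open import Data.Nat.Properties using (≤-refl; ≤-reflexive; ≤-trans; <-≤-trans; <-irrefl; module ≤-Reasoning)
  open import Data.Fin using (Fin)
  open import Data.Fin.Properties using (_≟_; any?)
  open import Data.List using (List; []; _∷_; length)
  open import Data.List.Membership.Propositional using (_∉_)
  open import Data.List.Membership.DecPropositional (_≟_ {n}) public using (_∈?_)
  open import Data.List.Relation.Unary.AllPairs using (_∷_)
  open import Data.List.Relation.Unary.All.Properties using (All¬⇒¬Any)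
  open import Data.List.Relation.Unary.Unique.Propositional using (Unique)
  open import Data.Product using (∃; _×_; _,_)
  open import Data.Empty using (⊥-elim)
  open import Relation.Binary.PropositionalEquality
  open import Relation.Nullary using (¬_; yes; no; does; ¬?)
  open import Relation.Nullary.Decidable using (dec-true; dec-false; _×-dec_)
  import Data.Bool.Properties as Bool

  members : List (Fin n) → ℕ
  members us = ∑[ z < n ] indicator (does (z ∈? us))

  ∑-isElement : ∀ x → ∑[ z < n ] indicator (does (z ≟ x)) ≡ 1
  ∑-isElement x = trans (∑-single _ x (λ z z≢x → cong indicator (dec-false (z ≟ x) z≢x)))
                        (cong indicator (dec-true (x ≟ x) refl))

  indicator-∨ : ∀ a b → indicator (a ∨ b) ≤ indicator a + indicator b
  indicator-∨ true  b = s≤s z≤n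
  indicator-∨ false b = ≤-refl

  members≤length : ∀ us → members us ≤ length us
  members≤length [] = ≤-reflexive (∑-zero (λ z → indicator (does (z ∈? []))) (λ _ → refl))
  members≤length (x ∷ us) = begin
    ∑[ z < n ] indicator (does (z ≟ x) ∨ does (z ∈? us))
      ≤⟨ ∑-mono (λ z → indicator-∨ (does (z ≟ x)) (does (z ∈? us))) ⟩
    ∑[ z < n ] (indicator (does (z ≟ x)) + indicator (does (z ∈? us)))
      ≡⟨ ∑-distrib-+ (λ z → indicator (does (z ≟ x))) (λ z → indicator (does (z ∈? us))) ⟩
    ∑[ z < n ] indicator (does (z ≟ x)) + members us
      ≡⟨ cong (_+ members us) (∑-isElement x) ⟩
    suc (members us)
      ≤⟨ s≤s (members≤length us) ⟩
    suc (length us) ∎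
    where open ≤-Reasoning

  members-unique : ∀ us → Unique us → members us ≡ length us
  members-unique [] _ = ∑-zero (λ z → indicator (does (z ∈? []))) (λ _ → refl)
  members-unique (x ∷ us) (x∉us ∷ unique) = begin
    ∑[ z < n ] indicator (does (z ≟ x) ∨ does (z ∈? us))
      ≡⟨ sum-cong-≗ split ⟩
    ∑[ z < n ] (indicator (does (z ≟ x)) + indicator (does (z ∈? us)))
      ≡⟨ ∑-distrib-+ (λ z → indicator (does (z ≟ x))) (λ z → indicator (does (z ∈? us))) ⟩
    ∑[ z < n ] indicator (does (z ≟ x)) + members us
      ≡⟨ cong₂ _+_ (∑-isElement x) (members-unique us unique) ⟩
    suc (length us) ∎
    where
    open ≡-Reasoning
    split : ∀ z → indicator (does (z ≟ x) ∨ does (z ∈? us))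
                ≡ indicator (does (z ≟ x)) + indicator (does (z ∈? us))
    split z with z ≟ x
    ... | yes refl rewrite dec-false (z ∈? us) (All¬⇒¬Any x∉us) = refl
    ... | no _ = refl

  pigeonhole : ∀ (f : Fin n → Bool) us → length us < ∑[ z < n ] indicator (f z) →
               ∃ λ z → f z ≡ true × z ∉ us
  pigeonhole f us many with any? (λ z → (f z Bool.≟ true) ×-dec ¬? (z ∈? us))
  ... | yes found = found
  ... | no none = ⊥-elim (<-irrefl refl (<-≤-trans many (≤-trans (∑-mono covered) (members≤length us))))
    where
    covered : ∀ z → indicator (f z) ≤ indicator (does (z ∈? us))
    covered z with f z in fz | z ∈? us
    ... | false | _     = z≤n
    ... | true  | yes _ = ≤-refl
    ... | true  | no z∉us = ⊥-elim (none (z , fz , z∉us))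

module TripleSystems (n : ℕ) where
  open Sums
  open import Data.Bool using (Bool; true)
  open import Data.Nat using (ℕ; _*_; _≤_; _<_)
  open import Data.Nat.Properties using (*-identityʳ)
  open import Data.Fin using (Fin)
  open import Data.Product using (_×_)
  open import Relation.Binary.PropositionalEquality using (_≡_; subst)

  Triples : Set
  Triples = Fin n → Fin n → Fin n → Bool

  _⊆_ : Triples → Triples → Set
  S' ⊆ S = ∀ a b c → S' a b c ≡ true → S a b c ≡ true

  card : Triples → ℕ
  card S = ∑[ a < n ] ∑[ b < n ] ∑[ c < n ] indicator (S a b c)

  card≤ : ∀ S → card S ≤ n * (n * n)
  card≤ S =
    ∑-≤-const (λ a → ∑[ b < n ] ∑[ c < n ] indicator (S a b c)) (n * n) λ a →
    ∑-≤-const (λ b → ∑[ c < n ] indicator (S a b c)) n λ b →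
    subst (∑[ c < n ] indicator (S a b c) ≤_) (*-identityʳ n)
          (∑-≤-const (λ c → indicator (S a b c)) 1 λ c → indicator≤1 (S a b c))

  codegUV codegVW codegWU : Triples → Fin n → Fin n → ℕ
  codegUV S a b = ∑[ c < n ] indicator (S a b c)
  codegVW S b c = ∑[ a < n ] indicator (S a b c)
  codegWU S c a = ∑[ b < n ] indicator (S a b c)

  Dense : ℕ → Triples → Set
  Dense t S = ∀ a b c → S a b c ≡ true →
              t < codegUV S a b × t < codegVW S b c × t < codegWU S c a

-- The potential (number of
-- covered pairs) drops with every deleted pair while |S| drops by at most t.
module Pruning (n t : ℕ) where
  open Sums
  open TripleSystems n
  open import Data.Bool using (true; false; _∧_; not)
  open import Data.Bool.Properties using (∧-identityʳ; ∧-zeroʳ)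
  open import Data.Nat using (ℕ; suc; _+_; _*_; _⊓_; _≤_; _<_; z≤n; s≤s; _≤?_; _<?_)
  open import Data.Nat.Properties
    using (≤-refl; ≤-trans; ≤-<-trans; ≤-pred; ≰⇒>; +-comm; +-assoc; *-suc; *-monoʳ-≤;
           +-mono-≤; +-mono-<-≤; +-monoʳ-≤; +-cancelʳ-<; +-identityʳ; *-identityʳ; ⊓-monoˡ-≤; m⊓n≤n; module ≤-Reasoning)
  open import Data.Fin using (Fin)
  open import Data.Fin.Properties using (_≟_; any?)
  open import Data.Product using (∃; _×_; _,_; proj₁; proj₂)
  open import Function using (_∘_)
  open import Data.Sum using (_⊎_; inj₁; inj₂)
  open import Data.Empty using (⊥-elim)
  open import Relation.Binary.PropositionalEquality
  open import Relation.Nullary using (¬_; yes; no; Dec; does)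
  open import Relation.Nullary.Decidable using (dec-true; _×-dec_; _⊎-dec_)

  pairsUV pairsVW pairsWU pairs : Triples → ℕ
  pairsUV S = ∑[ a < n ] ∑[ b < n ] (codegUV S a b ⊓ 1)
  pairsVW S = ∑[ b < n ] ∑[ c < n ] (codegVW S b c ⊓ 1)
  pairsWU S = ∑[ c < n ] ∑[ a < n ] (codegWU S c a ⊓ 1)
  pairs S = pairsUV S + pairsVW S + pairsWU S

  pairs≤ : ∀ S → pairs S ≤ 3 * (n * n)
  pairs≤ S = subst (pairs S ≤_) (thrice (n * n))
    (+-mono-≤ (+-mono-≤ (atMost (codegUV S)) (atMost (codegVW S))) (atMost (codegWU S)))
    where
    thrice : ∀ m → m + m + m ≡ 3 * m
    thrice m = trans (+-assoc m m m) (cong (λ k → m + (m + k)) (sym (+-identityʳ m)))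
    atMost : (f : Fin n → Fin n → ℕ) → ∑[ x < n ] ∑[ y < n ] (f x y ⊓ 1) ≤ n * n
    atMost f = ∑-≤-const (λ x → ∑[ y < n ] (f x y ⊓ 1)) n λ x →
      subst (∑[ y < n ] (f x y ⊓ 1) ≤_) (*-identityʳ n) (∑-≤-const (λ y → f x y ⊓ 1) 1 (λ y → m⊓n≤n (f x y) 1))

  ∑∑⊓1-mono : ∀ {f g : Fin n → Fin n → ℕ} → (∀ x y → f x y ≤ g x y) →
              ∑[ x < n ] ∑[ y < n ] (f x y ⊓ 1) ≤ ∑[ x < n ] ∑[ y < n ] (g x y ⊓ 1)
  ∑∑⊓1-mono f≤g = ∑-mono (λ x → ∑-mono (λ y → ⊓-monoˡ-≤ 1 (f≤g x y)))

  pairsVW-mono : ∀ {S' S} → S' ⊆ S → pairsVW S' ≤ pairsVW S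
  pairsVW-mono S'⊆S = ∑∑⊓1-mono (λ b c → ∑-mono (λ a → indicator-mono (S'⊆S a b c)))

  pairsWU-mono : ∀ {S' S} → S' ⊆ S → pairsWU S' ≤ pairsWU S
  pairsWU-mono S'⊆S = ∑∑⊓1-mono (λ c a → ∑-mono (λ b → indicator-mono (S'⊆S a b c)))

  deleteUV : Triples → Fin n → Fin n → Triples
  deleteUV S a₀ b₀ a b c = S a b c ∧ not (does (a ≟ a₀) ∧ does (b ≟ b₀))

  deleteUV-⊆ : ∀ S a₀ b₀ → deleteUV S a₀ b₀ ⊆ S
  deleteUV-⊆ S a₀ b₀ a b c kept with S a b c
  ... | true  = refl
  ... | false = kept

  deleteUV-away : ∀ S a₀ b₀ a b c → ¬ (a ≡ a₀ × b ≡ b₀) → deleteUV S a₀ b₀ a b c ≡ S a b c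
  deleteUV-away S a₀ b₀ a b c away with a ≟ a₀ | b ≟ b₀
  ... | yes a≡a₀ | yes b≡b₀ = ⊥-elim (away (a≡a₀ , b≡b₀))
  ... | yes _    | no _     = ∧-identityʳ _
  ... | no _     | _        = ∧-identityʳ _

  deleteUV-at : ∀ S a₀ b₀ c → deleteUV S a₀ b₀ a₀ b₀ c ≡ false
  deleteUV-at S a₀ b₀ c rewrite dec-true (a₀ ≟ a₀) refl | dec-true (b₀ ≟ b₀) refl = ∧-zeroʳ (S a₀ b₀ c)

  codegUV-deleted : ∀ S a₀ b₀ → codegUV (deleteUV S a₀ b₀) a₀ b₀ ≡ 0
  codegUV-deleted S a₀ b₀ = ∑-zero _ λ c → cong indicator (deleteUV-at S a₀ b₀ c)

  card-deleteUV : ∀ S a₀ b₀ → card S ≡ card (deleteUV S a₀ b₀) + codegUV S a₀ b₀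
  card-deleteUV S a₀ b₀ =
    ∑-bump (λ a → ∑[ b < n ] codegUV S' a b) (λ a → ∑[ b < n ] codegUV S a b) a₀ _
      (λ a a≢a₀ → sum-cong-≗ λ b → sum-cong-≗ λ c →
        cong indicator (sym (deleteUV-away S a₀ b₀ a b c (a≢a₀ ∘ proj₁))))
      (∑-bump (codegUV S' a₀) (codegUV S a₀) b₀ _
        (λ b b≢b₀ → sum-cong-≗ λ c → cong indicator (sym (deleteUV-away S a₀ b₀ a₀ b c (b≢b₀ ∘ proj₂))))
        (cong (_+ codegUV S a₀ b₀) (sym (codegUV-deleted S a₀ b₀))))
    where S' = deleteUV S a₀ b₀

  pairs-deleteUV : ∀ S a₀ b₀ → 0 < codegUV S a₀ b₀ → pairs (deleteUV S a₀ b₀) < pairs S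
  pairs-deleteUV S a₀ b₀ covered =
    +-mono-<-≤ (+-mono-<-≤ pairsUV-drops (pairsVW-mono S'⊆S)) (pairsWU-mono S'⊆S)
    where
    S' = deleteUV S a₀ b₀
    S'⊆S = deleteUV-⊆ S a₀ b₀
    codeg≤ : ∀ a b → codegUV S' a b ⊓ 1 ≤ codegUV S a b ⊓ 1
    codeg≤ a b = ⊓-monoˡ-≤ 1 (∑-mono (λ c → indicator-mono (S'⊆S a b c)))
    at-pair : codegUV S' a₀ b₀ ⊓ 1 < codegUV S a₀ b₀ ⊓ 1
    at-pair = subst (λ k → k ⊓ 1 < codegUV S a₀ b₀ ⊓ 1) (sym (codegUV-deleted S a₀ b₀))
                    (positive (codegUV S a₀ b₀) covered)
      where
      positive : ∀ k → 0 < k → 0 < k ⊓ 1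
      positive (suc k) _ = s≤s z≤n
    pairsUV-drops : pairsUV S' < pairsUV S
    pairsUV-drops = ∑-mono-< (λ a → ∑-mono (codeg≤ a)) a₀ (∑-mono-< (codeg≤ a₀) b₀ at-pair)

  -- Cyclic relabelling U → V → W → U; it lets us treat only UV-pairs.
  rotate : Triples → Triples
  rotate S x y z = S z x y

  pairs-rotate : ∀ S → pairs (rotate S) ≡ pairs S
  pairs-rotate S = trans (+-comm (pairsVW S + pairsWU S) (pairsUV S))
                         (sym (+-assoc (pairsUV S) (pairsVW S) (pairsWU S)))

  card-rotate : ∀ S → card (rotate S) ≡ card S
  card-rotate S = sym (trans (∑-comm (λ a b → codegUV S a b))
                             (sum-cong-≗ λ b → ∑-comm (λ a c → indicator (S a b c))))

  -- The deletion process keeps |S| > t · pairs S.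
  Heavy : Triples → Set
  Heavy S = t * pairs S < card S

  Step : Triples → Set
  Step S = ∃ λ S' → S' ⊆ S × pairs S' < pairs S × Heavy S'

  heavy-rotate : ∀ S → Heavy S → Heavy (rotate S)
  heavy-rotate S = subst₂ _<_ (cong (t *_) (sym (pairs-rotate S))) (sym (card-rotate S))

  unrotate : ∀ S → Step (rotate S) → Step S
  unrotate S (S' , S'⊆ , fewer , heavy) =
    rotate (rotate S') , (λ a b c → S'⊆ b c a) ,
    subst (_< pairs S) (sym pairs≡) (subst (pairs S' <_) (pairs-rotate S) fewer) ,
    subst₂ _<_ (cong (t *_) (sym pairs≡)) (sym card≡) heavy
    where
    pairs≡ = trans (pairs-rotate (rotate S')) (pairs-rotate S')
    card≡  = trans (card-rotate (rotate S')) (card-rotate S')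

  SparseUV : Triples → Set
  SparseUV S = ∃ λ a → ∃ λ b → 0 < codegUV S a b × codegUV S a b ≤ t

  sparseUV? : ∀ S → Dec (SparseUV S)
  sparseUV? S = any? λ a → any? λ b → (0 <? codegUV S a b) ×-dec (codegUV S a b ≤? t)

  Sparse : Triples → Set
  Sparse S = SparseUV S ⊎ SparseUV (rotate S) ⊎ SparseUV (rotate (rotate S))

  sparse? : ∀ S → Dec (Sparse S)
  sparse? S = sparseUV? S ⊎-dec sparseUV? (rotate S) ⊎-dec sparseUV? (rotate (rotate S))

  -- deleting a sparse pair costs at most t triples but one unit of potential
  stepUV : ∀ S → SparseUV S → Heavy S → Step S
  stepUV S (a₀ , b₀ , covered , few) heavy =
    S' , deleteUV-⊆ S a₀ b₀ , pairs-deleteUV S a₀ b₀ covered , +-cancelʳ-< t _ _ (begin-strict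
      t * pairs S' + t     ≡⟨ +-comm (t * pairs S') t ⟩
      t + t * pairs S'     ≡⟨ *-suc t (pairs S') ⟨
      t * suc (pairs S')   ≤⟨ *-monoʳ-≤ t (pairs-deleteUV S a₀ b₀ covered) ⟩
      t * pairs S          <⟨ heavy ⟩
      card S               ≡⟨ card-deleteUV S a₀ b₀ ⟩
      card S' + codegUV S a₀ b₀ ≤⟨ +-monoʳ-≤ (card S') few ⟩
      card S' + t          ∎)
    where
    open ≤-Reasoning
    S' = deleteUV S a₀ b₀

  step : ∀ S → Sparse S → Heavy S → Step S
  step S (inj₁ sparse) heavy = stepUV S sparse heavy
  step S (inj₂ (inj₁ sparse)) heavy = unrotate S (stepUV (rotate S) sparse (heavy-rotate S heavy))
  step S (inj₂ (inj₂ sparse)) heavy = unrotate S (step (rotate S) (inj₂ (inj₁ sparse)) (heavy-rotate S heavy))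

  ¬sparse⇒dense : ∀ S → ¬ Sparse S → Dense t S
  ¬sparse⇒dense S ¬sparse a b c abc =
      exceeds (codegUV S a b) (λ pos few → inj₁ (a , b , pos , few)) (term-positive⇒ _ c (indicator-true abc))
    , exceeds (codegVW S b c) (λ pos few → inj₂ (inj₁ (b , c , pos , few))) (term-positive⇒ _ a (indicator-true abc))
    , exceeds (codegWU S c a) (λ pos few → inj₂ (inj₂ (c , a , pos , few))) (term-positive⇒ _ b (indicator-true abc))
    where
    exceeds : ∀ k → (0 < k → k ≤ t → Sparse S) → 0 < k → t < k
    exceeds k sparse pos with k ≤? t
    ... | yes k≤t = ⊥-elim (¬sparse (sparse pos k≤t))
    ... | no  k≰t = ≰⇒> k≰t

  -- Delete sparse pairs until none is left; the potential bounds the number of steps.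
  pruning : ∀ S → Heavy S → ∃ λ S' → S' ⊆ S × Dense t S' × 0 < card S'
  pruning S = go (suc (pairs S)) S ≤-refl
    where
    go : ∀ k S → pairs S < k → Heavy S → ∃ λ S' → S' ⊆ S × Dense t S' × 0 < card S'
    go (suc k) S bound heavy with sparse? S
    ... | no ¬sparse = S , (λ _ _ _ abc → abc) , ¬sparse⇒dense S ¬sparse , ≤-<-trans z≤n heavy
    ... | yes sparse with step S sparse heavy
    ...   | S' , S'⊆S , fewer , heavy' with go k S' (≤-trans fewer (≤-pred bound)) heavy'
    ...     | S'' , S''⊆S' , dense , nonempty = S'' , (λ a b c → S'⊆S a b c ∘ S''⊆S' a b c) , dense , nonempty

-- Chains: lists of triples (newest first) in which consecutive triples
-- (a,b,c), (a₀,b₀,c₀) are linked through (a,b,c₀) and (a,b₀,c₀), so that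
-- c b a c₀ b₀ a₀ … is a tight walk.
module Chains (n : ℕ) where
  open TripleSystems n
  open Membership n
  open import Data.Bool using (true)
  open import Data.Nat using (ℕ; zero; suc; _+_; _≤_; _<_; z≤n; s≤s)
  open import Data.Nat.Properties using (≤-<-trans; ≤-trans; ≤-reflexive; +-identityʳ; +-suc; m<m+n)
  open import Data.Fin using (Fin)
  open import Data.Fin.Patterns using (0F; 1F; 2F)
  open import Data.List using (List; []; _∷_; map; length)
  open import Data.List.Properties using (length-map)
  open import Data.List.Relation.Unary.All using (All; []; _∷_)
  open import Data.List.Relation.Unary.All.Properties using (¬Any⇒All¬)
  open import Data.List.Relation.Unary.AllPairs using ([]; _∷_)
  open import Data.List.Relation.Unary.Unique.Propositional using (Unique)
  open import Data.Product using (∃; _×_; _,_; proj₁; proj₂)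
  open import Data.Unit using (⊤)
  open import Relation.Binary.PropositionalEquality

  Triple : Set
  Triple = Fin n × Fin n × Fin n

  coord : Fin 3 → Triple → Fin n
  coord 0F (a , _ , _) = a
  coord 1F (_ , b , _) = b
  coord 2F (_ , _ , c) = c

  Chain : Triples → List Triple → Set
  Chain S [] = ⊤
  Chain S ((a , b , c) ∷ []) = S a b c ≡ true
  Chain S ((a , b , c) ∷ (a₀ , b₀ , c₀) ∷ rs) =
    S a b c ≡ true × S a b c₀ ≡ true × S a b₀ c₀ ≡ true × Chain S ((a₀ , b₀ , c₀) ∷ rs)

  Distinct : List Triple → Set
  Distinct rs = ∀ i → Unique (map (coord i) rs)

  InSystem : Triples → Triple → Set
  InSystem S (a , b , c) = S a b c ≡ true

  chain-members : ∀ {S} rs → Chain S rs → All (InSystem S) rs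
  chain-members [] _ = []
  chain-members (_ ∷ []) abc = abc ∷ []
  chain-members (_ ∷ r₀ ∷ rs) (abc , _ , _ , chain) = abc ∷ chain-members (r₀ ∷ rs) chain

  module Greedy {t : ℕ} {S : Triples} (dense : Dense t S) where

    fewer : ∀ L i {k} → length L ≤ t → t < k → length (map (coord i) L) < k
    fewer L i L≤t t<k = ≤-<-trans (≤-trans (≤-reflexive (length-map (coord i) L)) L≤t) t<k

    -- One step: choose a' ∉ as, then b' ∉ bs, then c' ∉ cs, each time using
    -- that the relevant codegree exceeds t ≥ the length of the chain.
    extend : ∀ a b c rs → length rs < t → Chain S ((a , b , c) ∷ rs) → Distinct ((a , b , c) ∷ rs) →
             ∃ λ r → Chain S (r ∷ (a , b , c) ∷ rs) × Distinct (r ∷ (a , b , c) ∷ rs)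
    extend a b c rs short chain distinct with chain-members ((a , b , c) ∷ rs) chain
    ... | abc ∷ _
        with pigeonhole (λ z → S z b c) (map (coord 0F) ((a , b , c) ∷ rs))
               (fewer ((a , b , c) ∷ rs) 0F short (proj₁ (proj₂ (dense a b c abc))))
    ... | a' , a'bc , a'-new
        with pigeonhole (λ z → S a' z c) (map (coord 1F) ((a , b , c) ∷ rs))
               (fewer ((a , b , c) ∷ rs) 1F short (proj₂ (proj₂ (dense a' b c a'bc))))
    ... | b' , a'b'c , b'-new
        with pigeonhole (λ z → S a' b' z) (map (coord 2F) ((a , b , c) ∷ rs))
               (fewer ((a , b , c) ∷ rs) 2F short (proj₁ (dense a' b' c a'b'c)))
    ... | c' , a'b'c' , c'-new = (a' , b' , c') , (a'b'c' , a'b'c , a'bc , chain) , distinct'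
      where
      distinct' : Distinct ((a' , b' , c') ∷ (a , b , c) ∷ rs)
      distinct' 0F = ¬Any⇒All¬ _ a'-new ∷ distinct 0F
      distinct' 1F = ¬Any⇒All¬ _ b'-new ∷ distinct 1F
      distinct' 2F = ¬Any⇒All¬ _ c'-new ∷ distinct 2F

    grow : ∀ k r rs → length rs + k ≡ t → Chain S (r ∷ rs) → Distinct (r ∷ rs) →
           ∃ λ rs' → length rs' ≡ suc t × Chain S rs' × Distinct rs'
    grow zero r rs len chain distinct =
      r ∷ rs , cong suc (trans (sym (+-identityʳ (length rs))) len) , chain , distinct
    grow (suc k) (a , b , c) rs len chain distinct
      with extend a b c rs (subst (length rs <_) len (m<m+n (length rs) (s≤s z≤n))) chain distinct
    ... | r' , chain' , distinct' = grow k r' ((a , b , c) ∷ rs) (trans (sym (+-suc (length rs) k)) len) chain' distinct'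

    longChain : ∀ a b c → S a b c ≡ true → ∃ λ rs → length rs ≡ suc t × Chain S rs × Distinct rs
    longChain a b c abc = grow t (a , b , c) [] refl abc (λ _ → [] ∷ [])

module PathOrder where
  open import Data.Nat using (suc; _+_; _*_)
  open import Data.Nat.Properties using (*-suc; +-comm; +-assoc)
  open import Relation.Binary.PropositionalEquality

  path-order : ∀ t → 3 * t + 1 + 2 ≡ 3 * suc t
  path-order t = sym (trans (*-suc 3 t) (trans (+-comm 3 (3 * t)) (sym (+-assoc (3 * t) 1 2))))

module ChainPaths {n : ℕ} (H : ThreeGraph n) where
  open TripleSystems n
  open Chains n
  open PathOrder
  open import Data.Bool using (true)
  open import Data.Nat using (suc; _+_; _*_)
  open import Data.Nat.Properties using (*-suc)
  open import Data.Fin using (Fin)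
  open import Data.Fin.Patterns using (0F; 1F; 2F)
  open import Data.List using (List; []; _∷_; map; length)
  open import Data.List.Membership.Propositional using (_∈_)
  open import Data.List.Relation.Unary.Any using (here; there)
  open import Data.List.Relation.Unary.All using (All; _∷_)
  open import Data.List.Relation.Unary.All.Properties using (¬Any⇒All¬; All¬⇒¬Any)
  open import Data.List.Relation.Unary.AllPairs using ([]; _∷_)
  open import Data.List.Relation.Unary.Unique.Propositional using (Unique)
  open import Data.Product using (_,_)
  open import Data.Unit using (tt)
  open import Relation.Nullary using (¬_)
  open import Function using (_∘_)
  open import Relation.Binary.PropositionalEquality

  edge-reverse : ∀ x y z → edge H x y z ≡ true → edge H z y x ≡ true
  edge-reverse x y z xyz = trans (sym₁₂ H z y x) (trans (sym₂₃ H y z x) (trans (sym₁₂ H y x z) xyz))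

  edge-swap₁₂ : ∀ x y z → edge H x y z ≡ true → edge H y x z ≡ true
  edge-swap₁₂ x y z xyz = trans (sym₁₂ H y x z) xyz

  edge-swap₂₃ : ∀ x y z → edge H x y z ≡ true → edge H x z y ≡ true
  edge-swap₂₃ x y z xyz = trans (sym₂₃ H x z y) xyz

  u v w : Fin n → Vertex n
  u a = 0F , a
  v b = 1F , b
  w c = 2F , c

  EdgesOf : Triples → Set
  EdgesOf S = ∀ a b c → S a b c ≡ true → edge H (u a) (v b) (w c) ≡ true

  vertexList : List Triple → List (Vertex n)
  vertexList [] = []
  vertexList ((a , b , c) ∷ rs) = w c ∷ v b ∷ u a ∷ vertexList rs

  length-vertexList : ∀ rs → length (vertexList rs) ≡ 3 * length rs
  length-vertexList [] = refl
  length-vertexList (r ∷ rs) = trans (cong (3 +_) (length-vertexList rs)) (sym (*-suc 3 (length rs)))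

  ∈-vertexList : ∀ {i x} rs → (i , x) ∈ vertexList rs → x ∈ map (coord i) rs
  ∈-vertexList (r ∷ rs) (here refl)                 = here refl
  ∈-vertexList (r ∷ rs) (there (here refl))         = here refl
  ∈-vertexList (r ∷ rs) (there (there (here refl))) = here refl
  ∈-vertexList (r ∷ rs) (there (there (there x∈))) = there (∈-vertexList rs x∈)

  -- vertices of different classes differ; those of one class are distinct coordinates
  unique-vertexList : ∀ rs → Distinct rs → Unique (vertexList rs)
  unique-vertexList [] _ = []
  unique-vertexList ((a , b , c) ∷ rs) distinct =
      ((λ ()) ∷ (λ ()) ∷ fresh 2F)
    ∷ ((λ ()) ∷ fresh 1F)
    ∷ fresh 0F
    ∷ unique-vertexList rs (tail ∘ distinct)
    where
    tail : ∀ {x xs} → Unique (x ∷ xs) → Unique xs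
    tail (_ ∷ unique) = unique
    fresh : ∀ i → All (λ y → ¬ (i , coord i (a , b , c)) ≡ y) (vertexList rs)
    fresh i with distinct i
    ... | x∉ ∷ _ = ¬Any⇒All¬ (vertexList rs) (All¬⇒¬Any x∉ ∘ ∈-vertexList {i} rs)

  -- the links of the chain are exactly the consecutive triples of the sequence
  edges-vertexList : ∀ {S} → EdgesOf S → ∀ rs → Chain S rs → ConsecutiveEdges H (vertexList rs)
  edges-vertexList E [] _ = tt
  edges-vertexList E ((a , b , c) ∷ []) abc = edge-reverse _ _ _ (E a b c abc) , tt
  edges-vertexList E ((a , b , c) ∷ (a₀ , b₀ , c₀) ∷ rs) (abc , abc₀ , ab₀c₀ , chain) =
    edge-reverse _ _ _ (E a b c abc) , edge-swap₁₂ _ _ _ (E a b c₀ abc₀) ,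
    edge-swap₂₃ _ _ _ (E a b₀ c₀ ab₀c₀) , edges-vertexList E ((a₀ , b₀ , c₀) ∷ rs) chain

  chainPath : ∀ {S} t rs → EdgesOf S → length rs ≡ suc t → Chain S rs → Distinct rs → TightPath H
  chainPath t rs E len chain distinct = record
    { ℓ        = 3 * t + 1
    ; vertices = vertexList rs
    ; size     = trans (length-vertexList rs) (trans (cong (3 *_) len) (sym (path-order t)))
    ; distinct = unique-vertexList rs distinct
    ; edges    = edges-vertexList E rs chain
    }

module Regions (n : ℕ) where
  open Sums
  open Membership n
  open import Data.Bool using (true; false; _∧_; not)
  open import Data.Nat using (ℕ; suc; _+_)
  open import Data.Fin using (Fin)
  open import Data.Fin.Subset using (Subset) renaming (∣_∣ to #_)
  open import Data.Vec using ([]; _∷_; lookup; tabulate)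
  open import Data.Vec.Properties using (lookup∘tabulate)
  open import Data.List using (List; length)
  open import Data.List.Membership.Propositional using (_∉_)
  open import Data.List.Relation.Unary.All as All using (All)
  open import Data.List.Relation.Unary.Unique.Propositional using (Unique)
  open import Data.Product using (_×_; _,_; proj₁)
  open import Data.Bool.Properties using (∧-zeroʳ)
  open import Data.Empty using (⊥; ⊥-elim)
  open import Relation.Binary.PropositionalEquality
  open import Relation.Nullary using (yes; no; does)

  Region : Set
  Region = Fin 3 → Subset n

  _∈ᴿ_ : Vertex n → Region → Set
  (i , x) ∈ᴿ R = lookup (R i) x ≡ true

  #≡∑ : ∀ {k} (A : Subset k) → # A ≡ ∑[ z < k ] indicator (lookup A z)
  #≡∑ []          = refl
  #≡∑ (true ∷ A)  = cong suc (#≡∑ A)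
  #≡∑ (false ∷ A) = #≡∑ A

  ∧-true : ∀ {x y} → x ∧ y ≡ true → x ≡ true × y ≡ true
  ∧-true {true} xy = refl , xy

  false≢true : false ≡ true → ⊥
  false≢true ()

  remove : Subset n → List (Fin n) → Subset n
  remove A us = tabulate λ z → lookup A z ∧ not (does (z ∈? us))

  remove-⊆ : ∀ A us z → lookup (remove A us) z ≡ true → lookup A z ≡ true
  remove-⊆ A us z kept = proj₁ (∧-true (trans (sym (lookup∘tabulate _ z)) kept))

  remove-∉ : ∀ A us z → lookup (remove A us) z ≡ true → z ∉ us
  remove-∉ A us z kept z∈us with z ∈? us | trans (sym (lookup∘tabulate _ z)) kept
  ... | yes _   | A∧false = false≢true (trans (sym (∧-zeroʳ (lookup A z))) A∧false)
  ... | no z∉us | _       = z∉us z∈us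

  #-remove : ∀ A us → Unique us → All (λ z → lookup A z ≡ true) us → # (remove A us) + length us ≡ # A
  #-remove A us unique us⊆A = begin
    # (remove A us) + length us
      ≡⟨ cong₂ _+_ (#≡∑ (remove A us)) (sym (members-unique us unique)) ⟩
    ∑[ z < n ] indicator (lookup (remove A us) z) + members us
      ≡⟨ sym (∑-distrib-+ (λ z → indicator (lookup (remove A us) z)) (λ z → indicator (does (z ∈? us)))) ⟩
    ∑[ z < n ] (indicator (lookup (remove A us) z) + indicator (does (z ∈? us)))
      ≡⟨ sum-cong-≗ split ⟩
    ∑[ z < n ] indicator (lookup A z)
      ≡⟨ sym (#≡∑ A) ⟩
    # A ∎
    where
    open ≡-Reasoning
    split : ∀ z → indicator (lookup (remove A us) z) + indicator (does (z ∈? us)) ≡ indicator (lookup A z)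
    split z rewrite lookup∘tabulate (λ z → lookup A z ∧ not (does (z ∈? us))) z
      with lookup A z in Az | z ∈? us
    ... | true  | yes _ = refl
    ... | true  | no  _ = refl
    ... | false | no  _ = refl
    ... | false | yes z∈us = ⊥-elim (false≢true (trans (sym Az) (All.lookup us⊆A z∈us)))

module RegionEdges {n : ℕ} (H : ThreeGraph n) where
  open Sums
  open TripleSystems n
  open Chains n
  open ChainPaths H
  open Regions n
  open import Data.Bool using (true; _∧_)
  open import Data.Nat using (ℕ; _*_; _≤_)
  open import Data.Fin using (Fin)
  open import Data.Fin.Patterns using (0F; 1F; 2F)
  open import Data.Vec using (lookup)
  open import Data.List using ([]; _∷_)
  open import Data.List.Relation.Unary.All using (All; []; _∷_)
  open import Data.Product using (_×_; _,_)
  open import Relation.Binary.PropositionalEquality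

  inside : Region → Triples
  inside R a b c = lookup (R 0F) a ∧ lookup (R 1F) b ∧ lookup (R 2F) c
                   ∧ edge H (u a) (v b) (w c)

  card-inside : ∀ R → card (inside R) ≡ e H (R 0F) (R 1F) (R 2F)
  card-inside R = sym (trans (∑≡sum n λ a → ∑ n λ b → ∑ n (f a b))
                       (sum-cong-≗ λ a → trans (∑≡sum n λ b → ∑ n (f a b)) (sum-cong-≗ λ b → ∑≡sum n (f a b))))
    where
    f : Fin n → Fin n → Fin n → ℕ
    f a b c = indicator (inside R a b c)

  edges≤ : ∀ R → e H (R 0F) (R 1F) (R 2F) ≤ n * (n * n)
  edges≤ R = subst (_≤ n * (n * n)) (card-inside R) (card≤ (inside R))

  inside⇒ : ∀ R a b c → inside R a b c ≡ true →
            lookup (R 0F) a ≡ true × lookup (R 1F) b ≡ true × lookup (R 2F) c ≡ true ×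
            edge H (u a) (v b) (w c) ≡ true
  inside⇒ R a b c abc with ∧-true abc
  ... | a∈ , bc with ∧-true bc
  ...   | b∈ , c with ∧-true c
  ...     | c∈ , abc-edge = a∈ , b∈ , c∈ , abc-edge

  inside-edges : ∀ R → EdgesOf (inside R)
  inside-edges R a b c abc with inside⇒ R a b c abc
  ... | _ , _ , _ , abc-edge = abc-edge

  inside-coords : ∀ R r → InSystem (inside R) r → ∀ i → (i , coord i r) ∈ᴿ R
  inside-coords R (a , b , c) abc i with inside⇒ R a b c abc | i
  ... | a∈ , _  , _  , _ | 0F = a∈
  ... | _  , b∈ , _  , _ | 1F = b∈
  ... | _  , _  , c∈ , _ | 2F = c∈

  vertices-inside : ∀ R rs → All (InSystem (inside R)) rs → All (_∈ᴿ R) (vertexList rs)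
  vertices-inside R [] [] = []
  vertices-inside R (r ∷ rs) (in-r ∷ in-rs) =
    at 2F ∷ at 1F ∷ at 0F ∷ vertices-inside R rs in-rs
    where at = inside-coords R r in-r

module Rounds {n : ℕ} (H : ThreeGraph n) (t : ℕ) where
  open Sums
  open TripleSystems n
  open Pruning n t using (pruning; pairs≤)
  open Chains n
  open ChainPaths H
  open Regions n
  open RegionEdges H
  open import Data.Nat using (ℕ; suc; _+_; _*_; _<_)
  open import Data.Nat.Properties using (≤-<-trans; *-monoʳ-≤)
  open import Data.Fin using (Fin)
  open import Data.Fin.Patterns using (0F; 1F; 2F)
  open import Data.Fin.Subset using () renaming (∣_∣ to #_)
  open import Data.List using (List; map; length)
  open import Data.List.Properties using (length-map)
  open import Data.List.Membership.Propositional using (_∈_)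
  open import Data.List.Relation.Unary.All as All using (All)
  open import Data.List.Relation.Unary.All.Properties using (map⁺)
  open import Data.Product using (_,_)
  open import Function using (_∘_)
  open import Relation.Binary.PropositionalEquality
  open import Relation.Nullary using (¬_)

  -- Every region whose three parts have the same size m, unless m is small,
  -- spans more than 3tn² edges: then rounds can be repeated until m is small.
  Rich : (ℕ → Set) → Set
  Rich Small = ∀ (R : Region) m → (∀ i → # (R i) ≡ m) → ¬ Small m →
               t * (3 * (n * n)) < e H (R 0F) (R 1F) (R 2F)

  record Round (R : Region) : Set where
    field
      path        : TightPath H
      path-length : ℓ path ≡ 3 * t + 1
      path-inside : All (_∈ᴿ R) (vertices path)
      rest        : Region
      rest-size   : ∀ i → # (rest i) + suc t ≡ # (R i)
      rest-⊆      : ∀ x → x ∈ᴿ rest → x ∈ᴿ R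
      rest-avoids : ∀ x → x ∈ vertices path → ¬ (x ∈ᴿ rest)

  chainRound : ∀ R {S} → S ⊆ inside R → ∀ rs → length rs ≡ suc t → Chain S rs → Distinct rs → Round R
  chainRound R {S} S⊆ rs len chain distinct = record
    { path        = chainPath t rs (λ a b c → inside-edges R a b c ∘ S⊆ a b c) len chain distinct
    ; path-length = refl
    ; path-inside = vertices-inside R rs members
    ; rest        = λ i → remove (R i) (used i)
    ; rest-size   = rest-size
    ; rest-⊆      = λ { (i , x) → remove-⊆ (R i) (used i) x }
    ; rest-avoids = λ { (i , x) x∈ kept → remove-∉ (R i) (used i) x kept (∈-vertexList rs x∈) }
    }
    where
    used : Fin 3 → List (Fin n)
    used i = map (coord i) rs
    members : All (InSystem (inside R)) rs
    members = All.map (λ { {a , b , c} → S⊆ a b c }) (chain-members rs chain)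
    -- the i-th coordinates are t + 1 distinct members of R i
    rest-size : ∀ i → # (remove (R i) (used i)) + suc t ≡ # (R i)
    rest-size i = subst (λ k → # (remove (R i) (used i)) + k ≡ # (R i)) (trans (length-map (coord i) rs) len)
                        (#-remove (R i) (used i) (distinct i) (map⁺ (All.map (λ {r} in-r → inside-coords R r in-r i) members)))

  -- Pruning finds a dense nonempty part of the edges inside R; a chain grows from any of its triples.
  round : ∀ R → t * (3 * (n * n)) < e H (R 0F) (R 1F) (R 2F) → Round R
  round R many with pruning (inside R) (≤-<-trans (*-monoʳ-≤ t (pairs≤ (inside R)))
                                                  (subst (t * (3 * (n * n)) <_) (sym (card-inside R)) many))
  ... | S , S⊆ , dense , nonempty with ∑-positive⇒ _ nonempty
  ... | a , a-pos with ∑-positive⇒ _ a-pos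
  ... | b , b-pos with ∑-positive⇒ _ b-pos
  ... | c , c-pos with Greedy.longChain dense a b c (indicator-positive c-pos)
  ... | rs , len , chain , distinct = chainRound R S⊆ rs len chain distinct

module Iteration {n : ℕ} (H : ThreeGraph n) (t : ℕ) (Small : ℕ → Set) (small? : ∀ m → Dec (Small m))
                 (rich : Rounds.Rich H t Small) where
  open Regions n
  open Rounds H t
  open PathOrder
  open import Data.Nat using (ℕ; suc; _+_; _*_; _<_; z≤n; s≤s)
  open import Data.Nat.Properties using (+-cancelʳ-≡; +-assoc; +-comm; *-distribˡ-+; m<n+m)
  open import Data.Nat.Induction using (<-rec)
  open import Data.Fin.Patterns using (0F)
  open import Data.Fin.Subset using () renaming (∣_∣ to #_)
  open import Data.List using (List; []; _∷_; _++_; map; concat; length)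
  open import Data.List.Properties using (length-++)
  open import Data.List.Relation.Unary.All as All using (All; [])
  open import Data.List.Relation.Unary.All.Properties using (++⁺)
  open import Data.List.Relation.Unary.AllPairs using ([])
  open import Data.List.Relation.Unary.Unique.Propositional using (Unique)
  import Data.List.Relation.Unary.Unique.Propositional.Properties as Unique
  open import Data.Product using (_,_)
  open import Relation.Binary.PropositionalEquality
  open import Relation.Nullary using (yes; no)

  covered : List (TightPath H) → List (Vertex n)
  covered Ps = concat (map vertices Ps)

  record Cover (R : Region) (m : ℕ) : Set where
    field
      paths    : List (TightPath H)
      lengths  : All (λ P → ℓ P ≡ 3 * t + 1) paths
      disjoint : Unique (covered paths)
      within   : All (_∈ᴿ R) (covered paths)
      leftover : ℕ
      small    : Small leftover
      counted  : length (covered paths) + 3 * leftover ≡ 3 * m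

  prepend : ∀ {R m} (r : Round R) → ∀ {m′} → suc t + m′ ≡ m → Cover (Round.rest r) m′ → Cover R m
  prepend {R} {m} r {m′} m≡ c = record
    { paths    = path ∷ paths
    ; lengths  = path-length All.∷ lengths
    ; disjoint = Unique.++⁺ (distinct path) disjoint
                   (λ (x∈path , x∈rest) → rest-avoids _ x∈path (All.lookup within x∈rest))
    ; within   = ++⁺ path-inside (All.map (rest-⊆ _) within)
    ; leftover = leftover
    ; small    = small
    ; counted  = begin
        length (vertices path ++ covered paths) + 3 * leftover
          ≡⟨ cong (_+ 3 * leftover) (length-++ (vertices path)) ⟩
        length (vertices path) + length (covered paths) + 3 * leftover
          ≡⟨ +-assoc (length (vertices path)) _ _ ⟩
        length (vertices path) + (length (covered paths) + 3 * leftover)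
          ≡⟨ cong₂ _+_ (trans (size path) (trans (cong (_+ 2) path-length) (path-order t))) counted ⟩
        3 * suc t + 3 * m′
          ≡⟨ *-distribˡ-+ 3 (suc t) m′ ⟨
        3 * (suc t + m′)
          ≡⟨ cong (3 *_) m≡ ⟩
        3 * m ∎
    }
    where
    open Round r
    open Cover c
    open ≡-Reasoning

  -- By well-founded induction on m: each round lowers m by t + 1.
  cover : ∀ m R → (∀ i → # (R i) ≡ m) → Cover R m
  cover = <-rec (λ m → ∀ R → (∀ i → # (R i) ≡ m) → Cover R m) coverStep
    where
    coverStep : ∀ m → (∀ {m′} → m′ < m → ∀ R → (∀ i → # (R i) ≡ m′) → Cover R m′) →
                ∀ R → (∀ i → # (R i) ≡ m) → Cover R m
    coverStep m rec R sizes with small? m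
    ... | yes small = record
      { paths = [] ; lengths = [] ; disjoint = [] ; within = []
      ; leftover = m ; small = small ; counted = refl }
    ... | no large = prepend r m≡ (rec (subst (m′ <_) m≡ (m<n+m m′ (s≤s z≤n))) rest sizes′)
      where
      r = round R (rich R m sizes large)
      open Round r using (rest; rest-size)
      m′ = # (rest 0F)
      sizes′ : ∀ i → # (rest i) ≡ m′
      sizes′ i = +-cancelʳ-≡ (suc t) _ _ (trans (rest-size i) (trans (sizes i) (sym (trans (rest-size 0F) (sizes 0F)))))
      m≡ : suc t + m′ ≡ m
      m≡ = trans (+-comm (suc t) m′) (trans (rest-size 0F) (sizes 0F))

module Embedding where
  open import Data.Nat as ℕ using (ℕ)
  open import Data.Integer as ℤ using (+_)
  import Data.Integer.Properties as ℤ
  open import Data.Integer.Solver using (module +-*-Solver)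
  open import Data.Rational using (ℚ; mkℚ; toℚᵘ; 0ℚ; _+_; _*_; _≤_; _<_; *≤*; *<*)
  open import Data.Rational.Properties using (normalize-coprime; toℚᵘ-injective; toℚᵘ-homo-+; toℚᵘ-homo-*)
  open import Data.Rational.Unnormalised as ℚᵘ using (mkℚᵘ; _≃_; *≡*)
  import Data.Rational.Unnormalised.Properties as ℚᵘ
  open import Data.Nat.Coprimality using (1-coprimeTo) renaming (sym to coprime-sym)
  open import Relation.Binary.PropositionalEquality

  ⟦⟧-mkℚ : ∀ k → ⟦ k ⟧ ≡ mkℚ (+ k) 0 (coprime-sym (1-coprimeTo k))
  ⟦⟧-mkℚ k = normalize-coprime (coprime-sym (1-coprimeTo k))

  ⟦⟧-toℚᵘ : ∀ k → toℚᵘ ⟦ k ⟧ ≡ mkℚᵘ (+ k) 0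
  ⟦⟧-toℚᵘ k = cong toℚᵘ (⟦⟧-mkℚ k)

  homomorphic : ∀ (f : ℕ → ℕ → ℕ) (_∙_ : ℚ → ℚ → ℚ) (_∘_ : ℚᵘ.ℚᵘ → ℚᵘ.ℚᵘ → ℚᵘ.ℚᵘ) →
                (∀ p q → toℚᵘ (p ∙ q) ≃ toℚᵘ p ∘ toℚᵘ q) →
                (∀ a b → mkℚᵘ (+ f a b) 0 ≃ mkℚᵘ (+ a) 0 ∘ mkℚᵘ (+ b) 0) →
                ∀ a b → ⟦ f a b ⟧ ≡ ⟦ a ⟧ ∙ ⟦ b ⟧
  homomorphic f _∙_ _∘_ homo integral a b = toℚᵘ-injective (begin
    toℚᵘ ⟦ f a b ⟧                 ≡⟨ ⟦⟧-toℚᵘ (f a b) ⟩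
    mkℚᵘ (+ f a b) 0               ≈⟨ integral a b ⟩
    mkℚᵘ (+ a) 0 ∘ mkℚᵘ (+ b) 0    ≡⟨ cong₂ _∘_ (⟦⟧-toℚᵘ a) (⟦⟧-toℚᵘ b) ⟨
    toℚᵘ ⟦ a ⟧ ∘ toℚᵘ ⟦ b ⟧        ≈⟨ ℚᵘ.≃-sym (homo ⟦ a ⟧ ⟦ b ⟧) ⟩
    toℚᵘ (⟦ a ⟧ ∙ ⟦ b ⟧)           ∎)
    where open ℚᵘ.≃-Reasoning

  ⟦⟧-+ : ∀ a b → ⟦ a ℕ.+ b ⟧ ≡ ⟦ a ⟧ + ⟦ b ⟧
  ⟦⟧-+ = homomorphic ℕ._+_ _+_ ℚᵘ._+_ toℚᵘ-homo-+ λ a b →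
    *≡* (trans (cong (ℤ._* + 1) (ℤ.pos-+ a b))
               (solve 2 (λ x y → (x :+ y) :* con (+ 1) := (x :* con (+ 1) :+ y :* con (+ 1)) :* con (+ 1)) refl (+ a) (+ b)))
    where open +-*-Solver

  ⟦⟧-* : ∀ a b → ⟦ a ℕ.* b ⟧ ≡ ⟦ a ⟧ * ⟦ b ⟧
  ⟦⟧-* = homomorphic ℕ._*_ _*_ ℚᵘ._*_ toℚᵘ-homo-* λ a b →
    *≡* (cong (ℤ._* + 1) (ℤ.pos-* a b))

  ⟦⟧-mono-≤ : ∀ {a b} → a ℕ.≤ b → ⟦ a ⟧ ≤ ⟦ b ⟧
  ⟦⟧-mono-≤ {a} {b} a≤b = subst₂ _≤_ (sym (⟦⟧-mkℚ a)) (sym (⟦⟧-mkℚ b))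
    (*≤* (subst₂ ℤ._≤_ (sym (ℤ.*-identityʳ (+ a))) (sym (ℤ.*-identityʳ (+ b))) (ℤ.+≤+ a≤b)))

  ⟦⟧-mono-< : ∀ {a b} → a ℕ.< b → ⟦ a ⟧ < ⟦ b ⟧
  ⟦⟧-mono-< {a} {b} a<b = subst₂ _<_ (sym (⟦⟧-mkℚ a)) (sym (⟦⟧-mkℚ b))
    (*<* (subst₂ ℤ._<_ (sym (ℤ.*-identityʳ (+ a))) (sym (ℤ.*-identityʳ (+ b))) (ℤ.+<+ a<b)))

  ⟦⟧-cancel-< : ∀ {a b} → ⟦ a ⟧ < ⟦ b ⟧ → a ℕ.< b
  ⟦⟧-cancel-< {a} {b} ⟦a⟧<⟦b⟧ with subst₂ _<_ (⟦⟧-mkℚ a) (⟦⟧-mkℚ b) ⟦a⟧<⟦b⟧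
  ... | *<* a1<b1 with subst₂ ℤ._<_ (ℤ.*-identityʳ (+ a)) (ℤ.*-identityʳ (+ b)) a1<b1
  ...   | ℤ.+<+ a<b = a<b

  ⟦⟧-nonNeg : ∀ a → 0ℚ ≤ ⟦ a ⟧
  ⟦⟧-nonNeg a = ⟦⟧-mono-≤ {0} {a} ℕ.z≤n

module Estimates where
  open Embedding
  open PathOrder
  open import Data.Nat as ℕ using (ℕ; zero; suc)
  import Data.Nat.Properties as ℕ
  open import Data.Integer as ℤ using (+_)
  open import Data.Rational
    using (ℚ; 0ℚ; 1ℚ; _+_; _*_; _-_; -_; _÷_; 1/_; ∣_∣; _≤_; _<_; _<?_; *<*; nonNegative; positive; Positive)
  open import Data.Rational.Properties
  open import Data.Rational.Solver using (module +-*-Solver)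
  open import Data.Product using (∃; _×_; _,_)
  open import Data.Sum using (inj₁; inj₂)
  open import Data.Empty using (⊥-elim)
  open import Relation.Binary.PropositionalEquality
  open import Relation.Nullary using (yes; no)
  open +-*-Solver using (solve; _:=_; _:+_; _:*_; _:-_; :-_; con)

  -p≤∣p∣ : ∀ p → - p ≤ ∣ p ∣
  -p≤∣p∣ p with ∣p∣≡p∨∣p∣≡-p p
  ... | inj₂ ∣p∣≡-p = ≤-reflexive (sym ∣p∣≡-p)
  ... | inj₁ ∣p∣≡p  = ≤-trans (neg-antimono-≤ 0≤p) (≤-trans 0≤p (≤-reflexive (sym ∣p∣≡p)))
    where 0≤p = ∣p∣≡p⇒0≤p ∣p∣≡p

  abs-lower : ∀ E X Y → ∣ E - X ∣ ≤ Y → X - Y ≤ E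
  abs-lower E X Y close = begin
    X - Y               ≤⟨ +-monoʳ-≤ X (neg-antimono-≤ (≤-trans (-p≤∣p∣ (E - X)) close)) ⟩
    X - (- (E - X))     ≡⟨ solve 2 (λ E X → X :- (:- (E :- X)) := E) refl E X ⟩
    E                   ∎
    where open ≤-Reasoning

  *-mono-nonNeg : ∀ {x₁ x₂ y₁ y₂} → 0ℚ ≤ x₁ → 0ℚ ≤ x₂ → x₁ ≤ y₁ → x₂ ≤ y₂ → x₁ * x₂ ≤ y₁ * y₂
  *-mono-nonNeg {x₁} {x₂} {y₁} 0≤x₁ 0≤x₂ x₁≤y₁ x₂≤y₂ =
    ≤-trans (*-monoʳ-≤-nonNeg x₂ {{nonNegative 0≤x₂}} x₁≤y₁)
            (*-monoˡ-≤-nonNeg y₁ {{nonNegative (≤-trans 0≤x₁ x₁≤y₁)}} x₂≤y₂)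

  0≤* : ∀ {x y} → 0ℚ ≤ x → 0ℚ ≤ y → 0ℚ ≤ x * y
  0≤* {x} {y} 0≤x 0≤y = ≤-trans (≤-reflexive (sym (*-zeroˡ y))) (*-monoʳ-≤-nonNeg y {{nonNegative 0≤y}} 0≤x)

  density : ∀ {ξ d δ N M₁ M₂ M₃ E} → 0ℚ ≤ d → 0ℚ ≤ ξ * N →
            ξ * N ≤ M₁ → ξ * N ≤ M₂ → ξ * N ≤ M₃ →
            ∣ E - d * M₁ * M₂ * M₃ ∣ ≤ δ * N * N * N → (d * ξ * ξ * ξ - δ) * N * N * N ≤ E
  density {ξ} {d} {δ} {N} {M₁} {M₂} {M₃} {E} 0≤d 0≤ξN ξN≤M₁ ξN≤M₂ ξN≤M₃ close = begin
    (d * ξ * ξ * ξ - δ) * N * N * N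
      ≡⟨ solve 4 (λ d ξ δ N → (d :* ξ :* ξ :* ξ :- δ) :* N :* N :* N
                              := d :* ((ξ :* N) :* (ξ :* N) :* (ξ :* N)) :- δ :* N :* N :* N) refl d ξ δ N ⟩
    d * ((ξ * N) * (ξ * N) * (ξ * N)) - δ * N * N * N
      ≤⟨ +-monoˡ-≤ (- (δ * N * N * N)) (*-monoˡ-≤-nonNeg d {{nonNegative 0≤d}}
           (*-mono-nonNeg (0≤* 0≤ξN 0≤ξN) 0≤ξN (*-mono-nonNeg 0≤ξN 0≤ξN ξN≤M₁ ξN≤M₂) ξN≤M₃)) ⟩
    d * (M₁ * M₂ * M₃) - δ * N * N * N
      ≡⟨ cong (_- δ * N * N * N) (solve 4 (λ d x y z → d :* (x :* y :* z) := d :* x :* y :* z) refl d M₁ M₂ M₃) ⟩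
    d * M₁ * M₂ * M₃ - δ * N * N * N
      ≤⟨ abs-lower E _ _ close ⟩
    E ∎
    where open ≤-Reasoning

  halve : ∀ c N → ⟦ 2 ⟧ * (c ÷ ⟦ 2 ⟧ * N) ≡ c * N
  halve c N = trans (solve 3 (λ c N h → con ⟦ 2 ⟧ :* (c :* h :* N) := c :* N :* (con ⟦ 2 ⟧ :* h)) refl c N (1/ ⟦ 2 ⟧))
                    (*-identityʳ (c * N))

  bracket : ∀ X N → 0ℚ < X → X ≤ ⟦ 3 ℕ.* N ⟧ → ∃ λ t → ⟦ 3 ℕ.* t ⟧ < X × X ≤ ⟦ 3 ℕ.* suc t ⟧
  bracket X zero    0<X X≤0 = ⊥-elim (<-irrefl refl (<-≤-trans 0<X X≤0))
  bracket X (suc N) 0<X X≤3N+3 with ⟦ 3 ℕ.* N ⟧ <? X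
  ... | yes 3N<X = N , 3N<X , X≤3N+3
  ... | no  3N≮X = bracket X N 0<X (≮⇒≥ 3N≮X)

  ≤-double : ∀ Q → 0ℚ ≤ Q → Q ≤ ⟦ 2 ⟧ * Q
  ≤-double Q 0≤Q = begin
    Q          ≡⟨ +-identityʳ Q ⟨
    Q + 0ℚ     ≤⟨ +-monoʳ-≤ Q 0≤Q ⟩
    Q + Q      ≡⟨ solve 1 (λ Q → Q :+ Q := con ⟦ 2 ⟧ :* Q) refl Q ⟩
    ⟦ 2 ⟧ * Q  ∎
    where open ≤-Reasoning

  0<1 : 0ℚ < 1ℚ
  0<1 = *<* (ℤ.+<+ (ℕ.s≤s ℕ.z≤n))

  positive-size : ∀ x n → 1ℚ ≤ x * ⟦ n ⟧ → 0 ℕ.< n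
  positive-size x zero    1≤0 = ⊥-elim (<-irrefl refl (<-≤-trans 0<1 (≤-trans 1≤0 (≤-reflexive (*-zeroʳ x)))))
  positive-size x (suc n) _   = ℕ.s≤s ℕ.z≤n

  module _ (n : ℕ) (0<n : 0 ℕ.< n) where
    n² : ℚ
    n² = ⟦ n ⟧ * ⟦ n ⟧

    ⟦n²⟧ : ⟦ n ℕ.* n ⟧ ≡ n²
    ⟦n²⟧ = ⟦⟧-* n n

    instance
      n²-positive : Positive n²
      n²-positive = positive (subst (0ℚ <_) ⟦n²⟧ (⟦⟧-mono-< (ℕ.*-mono-< 0<n 0<n)))

    scale-< : ∀ a K → ⟦ a ⟧ < K → ⟦ a ℕ.* (n ℕ.* n) ⟧ < K * ⟦ n ⟧ * ⟦ n ⟧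
    scale-< a K a<K = begin-strict
      ⟦ a ℕ.* (n ℕ.* n) ⟧ ≡⟨ trans (⟦⟧-* a (n ℕ.* n)) (cong (⟦ a ⟧ *_) ⟦n²⟧) ⟩
      ⟦ a ⟧ * n²          <⟨ *-monoˡ-<-pos n² a<K ⟩
      K * n²              ≡⟨ *-assoc K ⟦ n ⟧ ⟦ n ⟧ ⟨
      K * ⟦ n ⟧ * ⟦ n ⟧   ∎
      where open ≤-Reasoning

    scale-cancel-≤ : ∀ K → K * ⟦ n ⟧ * ⟦ n ⟧ ≤ ⟦ n ℕ.* (n ℕ.* n) ⟧ → K ≤ ⟦ n ⟧
    scale-cancel-≤ K Kn²≤n³ = *-cancelʳ-≤-pos n² (begin
      K * n²              ≡⟨ *-assoc K ⟦ n ⟧ ⟦ n ⟧ ⟨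
      K * ⟦ n ⟧ * ⟦ n ⟧   ≤⟨ Kn²≤n³ ⟩
      ⟦ n ℕ.* (n ℕ.* n) ⟧ ≡⟨ trans (⟦⟧-* n (n ℕ.* n)) (cong (⟦ n ⟧ *_) ⟦n²⟧) ⟩
      ⟦ n ⟧ * n²          ∎)
      where open ≤-Reasoning

  length-bound : ∀ Q t → 1ℚ ≤ Q → ⟦ 2 ⟧ * Q ≤ ⟦ 3 ℕ.* suc t ⟧ → Q - ⟦ 2 ⟧ ≤ ⟦ 3 ℕ.* t ℕ.+ 1 ⟧
  length-bound Q t 1≤Q 2Q≤3t+3 = begin
    Q - ⟦ 2 ⟧                       ≤⟨ +-monoˡ-≤ (- ⟦ 2 ⟧) (≤-trans (≤-double Q (≤-trans (<⇒≤ 0<1) 1≤Q)) 2Q≤3t+3) ⟩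
    ⟦ 3 ℕ.* suc t ⟧ - ⟦ 2 ⟧         ≡⟨ cong (_- ⟦ 2 ⟧) (trans (cong ⟦_⟧ (sym (path-order t))) (⟦⟧-+ (3 ℕ.* t ℕ.+ 1) 2)) ⟩
    ⟦ 3 ℕ.* t ℕ.+ 1 ⟧ + ⟦ 2 ⟧ - ⟦ 2 ⟧ ≡⟨ solve 2 (λ a b → a :+ b :- b := a) refl ⟦ 3 ℕ.* t ℕ.+ 1 ⟧ ⟦ 2 ⟧ ⟩
    ⟦ 3 ℕ.* t ℕ.+ 1 ⟧                ∎
    where open ≤-Reasoning

  coverage : ∀ ξ len leftover n → len ℕ.+ 3 ℕ.* leftover ≡ 3 ℕ.* n → ⟦ leftover ⟧ ≤ ξ * ⟦ n ⟧ →
             (1ℚ - ξ) * ⟦ 3 ⟧ * ⟦ n ⟧ ≤ ⟦ len ⟧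
  coverage ξ len leftover n counted few = begin
    (1ℚ - ξ) * ⟦ 3 ⟧ * ⟦ n ⟧
      ≡⟨ solve 2 (λ ξ n → (con 1ℚ :- ξ) :* con ⟦ 3 ⟧ :* n := con ⟦ 3 ⟧ :* n :- con ⟦ 3 ⟧ :* (ξ :* n)) refl ξ ⟦ n ⟧ ⟩
    ⟦ 3 ⟧ * ⟦ n ⟧ - ⟦ 3 ⟧ * (ξ * ⟦ n ⟧)
      ≡⟨ cong (_- ⟦ 3 ⟧ * (ξ * ⟦ n ⟧)) total ⟩
    ⟦ len ⟧ + ⟦ 3 ⟧ * ⟦ leftover ⟧ - ⟦ 3 ⟧ * (ξ * ⟦ n ⟧)
      ≤⟨ +-monoʳ-≤ (⟦ len ⟧ + ⟦ 3 ⟧ * ⟦ leftover ⟧) (neg-antimono-≤ (*-monoˡ-≤-nonNeg ⟦ 3 ⟧ few)) ⟩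
    ⟦ len ⟧ + ⟦ 3 ⟧ * ⟦ leftover ⟧ - ⟦ 3 ⟧ * ⟦ leftover ⟧
      ≡⟨ solve 2 (λ l r → l :+ r :- r := l) refl ⟦ len ⟧ (⟦ 3 ⟧ * ⟦ leftover ⟧) ⟩
    ⟦ len ⟧ ∎
    where
    open ≤-Reasoning
    total : ⟦ 3 ⟧ * ⟦ n ⟧ ≡ ⟦ len ⟧ + ⟦ 3 ⟧ * ⟦ leftover ⟧
    total = trans (sym (⟦⟧-* 3 n)) (trans (cong ⟦_⟧ (sym counted))
                  (trans (⟦⟧-+ len (3 ℕ.* leftover)) (cong (λ x → ⟦ len ⟧ + x) (⟦⟧-* 3 leftover))))

module Counting {n : ℕ} (H : ThreeGraph n) where
  open Regions n using (Region)
  open Embedding using (⟦⟧-nonNeg)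
  open Estimates using (density; 0≤*)
  open import Data.Fin.Patterns using (0F; 1F; 2F)
  open import Data.Fin.Subset using () renaming (∣_∣ to #_)
  open import Data.Rational using (0ℚ; _-_; _*_; _≤_)

  quasirandom-count : ∀ {ξ d δ} → 0ℚ ≤ d → 0ℚ ≤ ξ → WeaklyQuasirandom δ d H →
                      ∀ (R : Region) → (∀ i → ξ * ⟦ n ⟧ ≤ ⟦ # (R i) ⟧) →
                      (d * ξ * ξ * ξ - δ) * ⟦ n ⟧ * ⟦ n ⟧ * ⟦ n ⟧ ≤ ⟦ e H (R 0F) (R 1F) (R 2F) ⟧
  quasirandom-count 0≤d 0≤ξ quasirandom R large =
    density 0≤d (0≤* 0≤ξ (⟦⟧-nonNeg n)) (large 0F) (large 1F) (large 2F) (quasirandom (R 0F) (R 1F) (R 2F))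

open import Data.Rational using (ℚ; 0ℚ; 1ℚ; _<_; _≤_; _-_; _*_; _÷_)
open import Data.Rational.Properties using (<⇒≤)

module Parameters (ξ d δ : ℚ) (n : ℕ) (0<ξ : 0ℚ < ξ) (0<d : 0ℚ < d)
                  (H : ThreeGraph n) (quasirandom : WeaklyQuasirandom δ d H) where
  open Regions n using (Region)
  open RegionEdges H using (edges≤)
  open Embedding using (⟦⟧-mono-≤; ⟦⟧-cancel-<)
  open Estimates using (bracket; halve; ≤-double; 0<1; positive-size; scale-<; scale-cancel-≤)
  open Counting H using (quasirandom-count)
  open import Data.Nat as ℕ using ()
  open import Data.Nat.Properties using (m≤n*m; *-assoc; *-comm)
  open import Data.Fin.Patterns using (0F; 1F; 2F)
  open import Data.Fin.Subset using () renaming (⊤ to whole; ∣_∣ to #_)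
  open import Data.Fin.Subset.Properties using (∣⊤∣≡n)
  open import Data.Rational using (_<?_)
  open import Data.Rational.Properties using (≤-trans; <-≤-trans; ≮⇒≥)
  open import Data.Product using (∃; _×_; proj₁; proj₂)
  open import Relation.Binary.PropositionalEquality using (_≡_; sym; trans; cong; subst)
  open import Relation.Nullary using (¬_)

  c Q : ℚ
  c = d * ξ * ξ * ξ - δ
  Q = c ÷ ⟦ 2 ⟧ * ⟦ n ⟧

  Small : ℕ → Set
  Small m = ⟦ m ⟧ < ξ * ⟦ n ⟧

  small? : ∀ m → Dec (Small m)
  small? m = ⟦ m ⟧ <? ξ * ⟦ n ⟧

  many-edges : ∀ (R : Region) → (∀ i → ξ * ⟦ n ⟧ ≤ ⟦ # (R i) ⟧) →
               ⟦ 2 ⟧ * Q * ⟦ n ⟧ * ⟦ n ⟧ ≤ ⟦ e H (R 0F) (R 1F) (R 2F) ⟧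
  many-edges R large =
    subst (_≤ ⟦ e H (R 0F) (R 1F) (R 2F) ⟧) (cong (λ x → x * ⟦ n ⟧ * ⟦ n ⟧) (sym (halve c ⟦ n ⟧)))
          (quasirandom-count {ξ} {d} {δ} (<⇒≤ 0<d) (<⇒≤ 0<ξ) quasirandom R large)

  module _ (1≤Q : 1ℚ ≤ Q) (n≮ξn : ¬ Small n) where
    0<n : 0 ℕ.< n
    0<n = positive-size (c ÷ ⟦ 2 ⟧) n 1≤Q

    -- for U, V, W themselves, as there are at most n³ triples: 2Q ≤ n
    2Q≤n : ⟦ 2 ⟧ * Q ≤ ⟦ n ⟧
    2Q≤n = scale-cancel-≤ n 0<n (⟦ 2 ⟧ * Q)
      (≤-trans (many-edges (λ _ → whole) (λ _ → subst (λ k → ξ * ⟦ n ⟧ ≤ ⟦ k ⟧) (sym (∣⊤∣≡n n)) (≮⇒≥ n≮ξn)))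
               (⟦⟧-mono-≤ (edges≤ (λ _ → whole))))

    choice : ∃ λ t → ⟦ 3 ℕ.* t ⟧ < ⟦ 2 ⟧ * Q × ⟦ 2 ⟧ * Q ≤ ⟦ 3 ℕ.* ℕ.suc t ⟧
    choice = bracket (⟦ 2 ⟧ * Q) n (<-≤-trans 0<1 (≤-trans 1≤Q (≤-double Q (≤-trans (<⇒≤ 0<1) 1≤Q))))
                                   (≤-trans 2Q≤n (⟦⟧-mono-≤ (m≤n*m n 3)))

    t : ℕ
    t = proj₁ choice

    rich : Rounds.Rich H t Small
    rich R m sizes large = ⟦⟧-cancel-<
      (subst (_< _) (cong ⟦_⟧ (trans (cong (ℕ._* (n ℕ.* n)) (*-comm 3 t)) (*-assoc t 3 (n ℕ.* n))))
        (<-≤-trans (scale-< n 0<n (3 ℕ.* t) _ (proj₁ (proj₂ choice)))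
                   (many-edges R (λ i → subst (λ k → ξ * ⟦ n ⟧ ≤ ⟦ k ⟧) (sym (sizes i)) (≮⇒≥ large)))))

open Iteration using (cover; module Cover)
open Estimates using (length-bound; coverage)
import Data.Nat as ℕ
open import Data.Fin.Subset using () renaming (⊤ to whole)
open import Data.Fin.Subset.Properties using (∣⊤∣≡n)
open import Data.List using ([]; length; concat; map)
open import Data.List.Relation.Unary.All as All using ([])
open import Data.List.Relation.Unary.AllPairs using ([])
open import Data.Product using (_,_; proj₂)
open import Relation.Binary.PropositionalEquality using (_≡_; refl; sym; subst)

-- If ξ > 1 the empty family suffices.
lemma6p2 : (ξ d δ : ℚ) (n : ℕ) →
    0ℚ < ξ → 0ℚ < d → 0ℚ < δ →
    1ℚ ≤ (d * ξ * ξ * ξ - δ) ÷ ⟦ 2 ⟧ * ⟦ n ⟧ →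
    (H : ThreeGraph n) → WeaklyQuasirandom δ d H →
    CoverByTightPaths H ((d * ξ * ξ * ξ - δ) ÷ ⟦ 2 ⟧ * ⟦ n ⟧ - ⟦ 2 ⟧)
    ((1ℚ - ξ) * ⟦ 3 ⟧ * ⟦ n ⟧)
lemma6p2 ξ d δ n 0<ξ 0<d _ 1≤Q H quasirandom = byCases (small? n)
  where
  open Parameters ξ d δ n 0<ξ 0<d H quasirandom
  byCases : Dec (Small n) → CoverByTightPaths H (Q - ⟦ 2 ⟧) ((1ℚ - ξ) * ⟦ 3 ⟧ * ⟦ n ⟧)
  byCases (yes n<ξn) = [] , [] , [] , coverage ξ 0 n n refl (<⇒≤ n<ξn)
  byCases (no  n≮ξn) =
    paths , All.map (λ {P} → long P) lengths , disjoint ,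
    coverage ξ (length (concat (map vertices paths))) leftover n counted (<⇒≤ small)
    where
    open Cover (cover H (t 1≤Q n≮ξn) Small small? (rich 1≤Q n≮ξn) n (λ _ → whole) (λ _ → ∣⊤∣≡n n))
    long : ∀ P → ℓ P ≡ 3 ℕ.* t 1≤Q n≮ξn ℕ.+ 1 → Q - ⟦ 2 ⟧ ≤ ⟦ ℓ P ⟧
    long P ℓ≡ = subst (λ k → Q - ⟦ 2 ⟧ ≤ ⟦ k ⟧) (sym ℓ≡) (length-bound Q (t 1≤Q n≮ξn) 1≤Q (proj₂ (proj₂ (choice 1≤Q n≮ξn))))
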